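{- The set of triples $(x,y,z)$ of words over $\{0,1,2\}$ of the same length such that $x$, $y$, $z$ are Chung-Graham words and $\mathrm{val}(x)+\mathrm{val}(y)=\mathrm{val}(z)$ is accepted by a finite automaton reading the three words in parallel, least significant digit first. Moreover, if $x$ and $y$ are Chung-Graham words of the same length $m\ge 2$ whose last two letters (the two most significant digits) are both $0$, then there exists a unique Chung-Graham word $z$ of length $m$ with $\mathrm{val}(x)+\mathrm{val}(y)=\mathrm{val}(z)$.
   Context: Fibonacci numbers: $F_0=0$, $F_1=1$, $F_{n+1}=F_n+F_{n-1}$ for $n\ge1$. For a word $a=a_0a_1\cdots a_{m-1}$ over $\{0,1,2\}$ (written least significant digit first), its value is $\mathrm{val}(a)=\sum_{i=0}^{m-1} a_iF_{i+2}$. A Chung-Graham word is a word over $\{0,1,2\}$ such that $a_i=0$ whenever $i$ is odd, and whenever $i<j$ are even indices with $a_i=a_j=2$ there is an even $k$ with $i<k<j$ and $a_k=0$. -}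

module Defs where

open import Data.Nat using (ℕ; zero; suc; _+_; _*_; _∸_; _<_; _%_)
open import Data.Fin using (Fin; toℕ)
open import Data.List using (List; []; _∷_; length; map; foldl)
open import Data.Product using (Σ; _×_; _,_; proj₁; proj₂; ∃)
open import Data.Bool using (Bool; true)
open import Relation.Binary.PropositionalEquality using (_≡_)

Digit : Set
Digit = Fin 3

-- Words, least significant digit first: position 0 is the head of the list.
Word : Set
Word = List Digit

fib : ℕ → ℕ
fib 0 = 0
fib 1 = 1
fib (suc (suc n)) = fib (suc n) + fib n

valFrom : ℕ → Word → ℕ
valFrom i [] = 0
valFrom i (d ∷ a) = toℕ d * fib (i + 2) + valFrom (suc i) a

val : Word → ℕ
val a = valFrom 0 a

-- The i-th letter a_i of a word, as a natural number (0 outside the word;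
-- only used at indices i < length a below).
digitAt : Word → ℕ → ℕ
digitAt [] i = 0
digitAt (d ∷ a) zero = toℕ d
digitAt (d ∷ a) (suc i) = digitAt a i

Even : ℕ → Set
Even n = n % 2 ≡ 0

Odd : ℕ → Set
Odd n = n % 2 ≡ 1

record ChungGraham (a : Word) : Set where
  field
    oddZero : ∀ i → i < length a → Odd i → digitAt a i ≡ 0
    twoSeparated : ∀ i j → i < j → j < length a → Even i → Even j →
                   digitAt a i ≡ 2 → digitAt a j ≡ 2 →
                   ∃ λ k → Even k × i < k × k < j × digitAt a k ≡ 0

-- Letters read in parallel: triples of digits. A list of triples is exactly
-- a triple of words of the same length.
Letter3 : Set
Letter3 = Digit × Digit × Digit

track₁ track₂ track₃ : List Letter3 → Word
track₁ = map proj₁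
track₂ = map (λ t → proj₁ (proj₂ t))
track₃ = map (λ t → proj₂ (proj₂ t))

record DFA (Σ : Set) : Set where
  field
    nStates : ℕ
    start   : Fin nStates
    step    : Fin nStates → Σ → Fin nStates
    final   : Fin nStates → Bool

  run : Fin nStates → List Σ → Fin nStates
  run q w = foldl step q w

  accepts : List Σ → Bool
  accepts w = final (run start w)

CGSum : List Letter3 → Set
CGSum w = ChungGraham (track₁ w) × ChungGraham (track₂ w) × ChungGraham (track₃ w)
        × val (track₁ w) + val (track₂ w) ≡ val (track₃ w)

{-# OPTIONS --safe #-}
-- Chung-Graham words are recognised, least significant digit first, by an automaton
-- whose state records the parity of the next position and whether a 2 at an even
-- position still waits for a 0 at a later even position. Along a run the value of
-- the prefix read so far stays below a Fibonacci bound (below F(n+2) at even length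
-- n). Comparing the last digits of two such words then shows that val is injective
-- on words of a given length, and choosing the top digit greedily represents every
-- number below the bound; the second part follows, since the values of x and y
-- below their two zero top digits sum to less than the bound for length m.
--
-- For addition, the weighted sum of the digit excesses e_i = x_i + y_i - z_i over the
-- positions i >= n equals a F(n+2) + b F(n+1) for a pair (a, b), the carry at n,
-- computed from the most significant end by (a, b) -> (a + b + e_n, a). When x, y, z
-- are Chung-Graham words with val x + val y = val z, the bounds on their prefixes
-- confine this sum at every even position n to an interval of length 3 F(n+2), which
-- leaves only eight possible carries at even and eight at odd positions, all in
-- [-2, 2]^2. So an automaton can follow the carry from the least significant end by
-- inverting the step, and accepts when the last carry is (0, 0).
module Submission where

open import Defs
open import Data.Bool as Bool using (Bool; true; false; not; _∧_; if_then_else_; b≤b)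
import Data.Bool.Properties as Bool
open import Data.Empty using (⊥-elim)
open import Data.Fin as Fin using (Fin; toℕ)
open import Data.Fin.Patterns using (0F; 1F; 2F; 3F; 4F)
open import Data.Fin.Properties using (toℕ-injective; 2↔Bool; 1↔⊤; +↔⊎; *↔×)
open import Data.Integer.Base as ℤ using (ℤ; +_; -[1+_]; 0ℤ; 1ℤ; +≤+; -≤-; -≤+)
import Data.Integer.Properties as ℤ
open import Data.Integer.Tactic.RingSolver using (solve-∀)
open import Data.List using (List; []; _∷_; _++_; _∷ʳ_; length; map; foldl)
open import Data.List.Properties using (foldl-∷ʳ; foldl-map; length-++-≤ˡ; map-++; ∷ʳ-++; ++-identityʳ; length-map)
open import Data.List.Reverse using (Reverse; reverseView; []; _∶_∶ʳ_)
open import Data.Maybe as Maybe using (Maybe; just; nothing; _>>=_; zip; maybe′)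
open import Data.Nat using (ℕ; zero; suc; _+_; _*_; _∸_; _<_; _≤_; _%_; z≤n; s≤s; _<?_; NonZero; >-nonZero)
open import Data.Nat.DivMod using ([m+kn]%n≡m%n; m<n⇒m%n≡m)
open import Data.Nat.Properties
  using (+-suc; +-identityʳ; +-comm; +-assoc; m<1+n⇒m<n∨m≡n; <-trans; <-≤-trans; ≤-<-trans; <-irrefl; ≤-refl; ≤-trans;
         m≤n⇒m≤1+n; m≤m+n; +-monoˡ-<; +-monoˡ-≤; +-mono-<; +-cancelˡ-≡; +-cancelˡ-<; *-cancelʳ-≡; suc-injective;
         m∸n+n≡m; m+[n∸m]≡n; ≮⇒≥; ≤⇒≯)
open import Data.Product using (Σ; ∃; ∃!; _×_; _,_; proj₁; proj₂)
open import Data.Product.Function.NonDependent.Propositional using (_×-↔_)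
open import Data.Product.Properties using (≡-dec)
open import Data.Sum using (_⊎_; inj₁; inj₂; [_,_])
open import Data.Sum.Function.Propositional using (_⊎-↔_)
open import Data.Unit using (⊤; tt)
open import Function.Bundles using (_⇔_; mk⇔; _↔_; Inverse; Equivalence; mk↔ₛ′)
open import Function.Properties.Inverse using (↔-refl; ↔-trans)
open import Relation.Binary.PropositionalEquality
  using (_≡_; _≢_; refl; sym; trans; cong; cong₂; subst; subst₂; module ≡-Reasoning)
open import Relation.Nullary using (¬_; contradiction; does; yes; no)
open import Relation.Nullary.Decidable using (dec-true)

evenᵇ : ℕ → Bool
evenᵇ zero    = true
evenᵇ (suc n) = not (evenᵇ n)

%2≡evenᵇ : ∀ n → n % 2 ≡ (if evenᵇ n then 0 else 1)
%2≡evenᵇ 0             = refl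
%2≡evenᵇ 1             = refl
%2≡evenᵇ (suc (suc n)) rewrite Bool.not-involutive (evenᵇ n) = %2≡evenᵇ n

Even⇒evenᵇ : ∀ n → Even n → evenᵇ n ≡ true
Even⇒evenᵇ n even with evenᵇ n | %2≡evenᵇ n
... | true  | _   = refl
... | false | n%2 = contradiction (trans (sym even) n%2) λ ()

Odd⇒evenᵇ : ∀ n → Odd n → evenᵇ n ≡ false
Odd⇒evenᵇ n odd with evenᵇ n | %2≡evenᵇ n
... | false | _   = refl
... | true  | n%2 = contradiction (trans (sym odd) n%2) λ ()

evenᵇ⇒Even : ∀ n → evenᵇ n ≡ true → Even n
evenᵇ⇒Even n p = trans (%2≡evenᵇ n) (cong (λ b → if b then 0 else 1) p)

evenᵇ⇒Odd : ∀ n → evenᵇ n ≡ false → Odd n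
evenᵇ⇒Odd n p = trans (%2≡evenᵇ n) (cong (λ b → if b then 0 else 1) p)

length-∷ʳ : ∀ {A : Set} (u : List A) a → length (u ∷ʳ a) ≡ suc (length u)
length-∷ʳ []      a = refl
length-∷ʳ (_ ∷ u) a = cong suc (length-∷ʳ u a)

digitAt-++ˡ : ∀ (u v : Word) {i} → i < length u → digitAt (u ++ v) i ≡ digitAt u i
digitAt-++ˡ (d ∷ u) v {zero}  _         = refl
digitAt-++ˡ (d ∷ u) v {suc i} (s≤s i<u) = digitAt-++ˡ u v i<u

digitAt-∷ʳ : ∀ (u : Word) d → digitAt (u ∷ʳ d) (length u) ≡ toℕ d
digitAt-∷ʳ []      d = refl
digitAt-∷ʳ (_ ∷ u) d = digitAt-∷ʳ u d

<-∷ʳ : ∀ {A : Set} (u : List A) a {i} → i < length u → i < length (u ∷ʳ a)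
<-∷ʳ u a i<u = subst (_ <_) (sym (length-∷ʳ u a)) (m≤n⇒m≤1+n i<u)

<-∷ʳ⁻ : ∀ {A : Set} (u : List A) a {i} → i < length (u ∷ʳ a) → i < length u ⊎ i ≡ length u
<-∷ʳ⁻ u a i<ua = m<1+n⇒m<n∨m≡n (subst (_ <_) (length-∷ʳ u a) i<ua)

length<∷ʳ : ∀ {A : Set} (u : List A) a → length u < length (u ∷ʳ a)
length<∷ʳ u a = subst (length u <_) (sym (length-∷ʳ u a)) ≤-refl

digitAt-∷ʳ-< : ∀ (u : Word) d {i} → i < length u → digitAt (u ∷ʳ d) i ≡ digitAt u i
digitAt-∷ʳ-< u d = digitAt-++ˡ u (d ∷ [])

valFrom-++ : ∀ i (u v : Word) → valFrom i (u ++ v) ≡ valFrom i u + valFrom (i + length u) v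
valFrom-++ i []      v rewrite +-identityʳ i = refl
valFrom-++ i (d ∷ u) v rewrite valFrom-++ (suc i) u v | +-suc i (length u) =
  sym (+-assoc (toℕ d * fib (i + 2)) (valFrom (suc i) u) _)

val-∷ʳ : ∀ u d → val (u ∷ʳ d) ≡ val u + toℕ d * fib (suc (suc (length u)))
val-∷ʳ u d = trans (valFrom-++ 0 u (d ∷ []))
  (cong (_+_ (val u)) (trans (+-identityʳ _) (cong (λ n → toℕ d * fib n) (+-comm (length u) 2))))

open ChungGraham

Settled : Word → Set
Settled w = ∀ i → i < length w → Even i → digitAt w i ≡ 2 →
            ∃ λ k → Even k × i < k × k < length w × digitAt w k ≡ 0

Pending : Word → Set
Pending w = ∃ λ i → i < length w × Even i × digitAt w i ≡ 2 ×
            (∀ k → Even k → i < k → k < length w → digitAt w k ≢ 0)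

chungGraham-++ˡ : ∀ (u v : Word) → ChungGraham (u ++ v) → ChungGraham u
chungGraham-++ˡ u v cg = record { oddZero = zeros ; twoSeparated = separated }
  where
  digit : ∀ {i} → i < length u → digitAt (u ++ v) i ≡ digitAt u i
  digit = digitAt-++ˡ u v

  widen : ∀ {i} → i < length u → i < length (u ++ v)
  widen i<u = <-≤-trans i<u (length-++-≤ˡ u)

  zeros : ∀ i → i < length u → Odd i → digitAt u i ≡ 0
  zeros i i<u odd = trans (sym (digit i<u)) (oddZero cg i (widen i<u) odd)

  separated : ∀ i j → i < j → j < length u → Even i → Even j → digitAt u i ≡ 2 → digitAt u j ≡ 2 →
              ∃ λ k → Even k × i < k × k < j × digitAt u k ≡ 0
  separated i j i<j j<u ei ej di dj
    with twoSeparated cg i j i<j (widen j<u) ei ej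
           (trans (digit (<-trans i<j j<u)) di) (trans (digit j<u) dj)
  ... | k , ek , i<k , k<j , dk = k , ek , i<k , k<j , trans (sym (digit (<-trans k<j j<u))) dk

chungGraham-∷ʳ : ∀ {w d} → ChungGraham w → (Odd (length w) → toℕ d ≡ 0) →
                 (Even (length w) → toℕ d ≡ 2 → Settled w) → ChungGraham (w ∷ʳ d)
chungGraham-∷ʳ {w} {d} cg oddLast twoLast = record { oddZero = zeros ; twoSeparated = separated }
  where
  zeros : ∀ i → i < length (w ∷ʳ d) → Odd i → digitAt (w ∷ʳ d) i ≡ 0
  zeros i i<wd odd with <-∷ʳ⁻ w d i<wd
  ... | inj₁ i<w  = trans (digitAt-∷ʳ-< w d i<w) (oddZero cg i i<w odd)
  ... | inj₂ refl = trans (digitAt-∷ʳ w d) (oddLast odd)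

  separated : ∀ i j → i < j → j < length (w ∷ʳ d) → Even i → Even j →
              digitAt (w ∷ʳ d) i ≡ 2 → digitAt (w ∷ʳ d) j ≡ 2 →
              ∃ λ k → Even k × i < k × k < j × digitAt (w ∷ʳ d) k ≡ 0
  separated i j i<j j<wd ei ej di dj with <-∷ʳ⁻ w d j<wd
  ... | inj₁ j<w
    with twoSeparated cg i j i<j j<w ei ej (trans (sym (digitAt-∷ʳ-< w d (<-trans i<j j<w))) di)
                                           (trans (sym (digitAt-∷ʳ-< w d j<w)) dj)
  ... | k , ek , i<k , k<j , dk = k , ek , i<k , k<j , trans (digitAt-∷ʳ-< w d (<-trans k<j j<w)) dk
  separated i j i<j j<wd ei ej di dj | inj₂ refl
    with twoLast ej (trans (sym (digitAt-∷ʳ w d)) dj) i i<j ei (trans (sym (digitAt-∷ʳ-< w d i<j)) di)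
  ... | k , ek , i<k , k<w , dk = k , ek , i<k , k<w , trans (digitAt-∷ʳ-< w d k<w) dk

chungGraham-∷ʳ-odd : ∀ {w d} → ChungGraham (w ∷ʳ d) → Odd (length w) → toℕ d ≡ 0
chungGraham-∷ʳ-odd {w} {d} cg odd =
  trans (sym (digitAt-∷ʳ w d)) (oddZero cg (length w) (length<∷ʳ w d) odd)

chungGraham-∷ʳ-two : ∀ {w d} → ChungGraham (w ∷ʳ d) → Even (length w) → toℕ d ≡ 2 → ¬ Pending w
chungGraham-∷ʳ-two {w} {d} cg even two (i , i<w , ei , di , noZero)
  with twoSeparated cg i (length w) i<w (length<∷ʳ w d) ei even
         (trans (digitAt-∷ʳ-< w d i<w) di) (trans (digitAt-∷ʳ w d) two)
... | k , ek , i<k , k<w , dk = noZero k ek i<k k<w (trans (sym (digitAt-∷ʳ-< w d k<w)) dk)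

settled-∷ʳ : ∀ {w d} → Settled w → toℕ d ≢ 2 → Settled (w ∷ʳ d)
settled-∷ʳ {w} {d} settled d≢2 i i<wd ei di with <-∷ʳ⁻ w d i<wd
... | inj₂ refl = contradiction (trans (sym (digitAt-∷ʳ w d)) di) d≢2
... | inj₁ i<w with settled i i<w ei (trans (sym (digitAt-∷ʳ-< w d i<w)) di)
...   | k , ek , i<k , k<w , dk = k , ek , i<k , <-∷ʳ w d k<w , trans (digitAt-∷ʳ-< w d k<w) dk

settled-∷ʳ-0 : ∀ {w d} → Even (length w) → toℕ d ≡ 0 → Settled (w ∷ʳ d)
settled-∷ʳ-0 {w} {d} even d≡0 i i<wd ei di with <-∷ʳ⁻ w d i<wd
... | inj₁ i<w  = length w , even , i<w , length<∷ʳ w d , trans (digitAt-∷ʳ w d) d≡0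
... | inj₂ refl = contradiction (trans (sym di) (trans (digitAt-∷ʳ w d) d≡0)) λ ()

pending-∷ʳ : ∀ {w d} → Pending w → (Even (length w) → toℕ d ≢ 0) → Pending (w ∷ʳ d)
pending-∷ʳ {w} {d} (i , i<w , ei , di , noZero) d≢0 =
  i , <-∷ʳ w d i<w , ei , trans (digitAt-∷ʳ-< w d i<w) di , noZero′
  where
  noZero′ : ∀ k → Even k → i < k → k < length (w ∷ʳ d) → digitAt (w ∷ʳ d) k ≢ 0
  noZero′ k ek i<k k<wd dk with <-∷ʳ⁻ w d k<wd
  ... | inj₁ k<w  = noZero k ek i<k k<w (trans (sym (digitAt-∷ʳ-< w d k<w)) dk)
  ... | inj₂ refl = d≢0 ek (trans (sym (digitAt-∷ʳ w d)) dk)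

pending-∷ʳ-2 : ∀ {w d} → Even (length w) → toℕ d ≡ 2 → Pending (w ∷ʳ d)
pending-∷ʳ-2 {w} {d} even d≡2 =
  length w , length<∷ʳ w d , even , trans (digitAt-∷ʳ w d) d≡2 , noZero
  where
  noZero : ∀ k → Even k → length w < k → k < length (w ∷ʳ d) → digitAt (w ∷ʳ d) k ≢ 0
  noZero k _ w<k k<wd _ with <-∷ʳ⁻ w d k<wd
  ... | inj₁ k<w  = <-irrefl refl (<-trans w<k k<w)
  ... | inj₂ refl = <-irrefl refl w<k

-- Partial deterministic automata

record Automaton (A : Set) : Set₁ where
  field
    State : Set
    start : State
    step  : State → A → Maybe State
    final : State → Bool

  step? : Maybe State → A → Maybe State
  step? m a = m >>= λ s → step s a

  run : Maybe State → List A → Maybe State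
  run = foldl step?

  accepts : List A → Bool
  accepts w = maybe′ final false (run (just start) w)

open Automaton

module _ {A : Set} (M : Automaton A) where

  data Reaches : List A → State M → Set where
    []     : Reaches [] (start M)
    _∷ʳ⟨_⟩ : ∀ {w s a s′} → Reaches w s → step M s a ≡ just s′ → Reaches (w ∷ʳ a) s′

  reaches⇒run : ∀ {w s} → Reaches w s → run M (just (start M)) w ≡ just s
  reaches⇒run []                         = refl
  reaches⇒run (_∷ʳ⟨_⟩ {w} {a = a} r eq) =
    trans (foldl-∷ʳ (step? M) _ a w) (trans (cong (λ m → step? M m a) (reaches⇒run r)) eq)

  run⇒reaches : ∀ {w s} → run M (just (start M)) w ≡ just s → Reaches w s
  run⇒reaches {w} = go (reverseView w)
    where
    go : ∀ {w s} → Reverse w → run M (just (start M)) w ≡ just s → Reaches w s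
    go []              refl = []
    go (w ∶ view ∶ʳ a) eq
      rewrite foldl-∷ʳ (step? M) (just (start M)) a w
      with run M (just (start M)) w in prefix
    ... | just s = go view prefix ∷ʳ⟨ eq ⟩

  accepts⇔reaches : ∀ w → accepts M w ≡ true ⇔ ∃ λ s → Reaches w s × final M s ≡ true
  accepts⇔reaches w = mk⇔ to (λ (s , r , fin) → trans (cong (maybe′ (final M) false) (reaches⇒run r)) fin)
    where
    to : accepts M w ≡ true → ∃ λ s → Reaches w s × final M s ≡ true
    to acc with run M (just (start M)) w in eq
    ... | just s = s , run⇒reaches eq , acc

_⊗_ : ∀ {A} → Automaton A → Automaton A → Automaton A
M ⊗ N = record
  { State = State M × State N
  ; start = start M , start N
  ; step  = λ (s , t) a → zip (step M s a) (step N t a)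
  ; final = λ (s , t) → final M s ∧ final N t
  }

comap : ∀ {A B} → (B → A) → Automaton A → Automaton B
comap f M = record
  { State = State M
  ; start = start M
  ; step  = λ s b → step M s (f b)
  ; final = final M
  }

module _ {A : Set} (M N : Automaton A) where

  step?-⊗ : ∀ m n a → step? (M ⊗ N) (zip m n) a ≡ zip (step? M m a) (step? N n a)
  step?-⊗ nothing  n        a = refl
  step?-⊗ (just s) nothing  a with step M s a
  ... | just _  = refl
  ... | nothing = refl
  step?-⊗ (just s) (just t) a = refl

  run-⊗ : ∀ m n w → run (M ⊗ N) (zip m n) w ≡ zip (run M m w) (run N n w)
  run-⊗ m n []      = refl
  run-⊗ m n (a ∷ w) rewrite step?-⊗ m n a = run-⊗ (step? M m a) (step? N n a) w

  accepts-⊗ : ∀ w → accepts (M ⊗ N) w ≡ accepts M w ∧ accepts N w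
  accepts-⊗ w rewrite run-⊗ (just (start M)) (just (start N)) w
    with run M (just (start M)) w | run N (just (start N)) w
  ... | just _  | just _  = refl
  ... | just _  | nothing = sym (Bool.∧-zeroʳ _)
  ... | nothing | _       = refl

accepts-comap : ∀ {A B} (f : B → A) (M : Automaton A) w → accepts (comap f M) w ≡ accepts M (map f w)
accepts-comap f M w = cong (maybe′ (final M) false) (sym (foldl-map (step? M) f (just (start M)) w))

Finite : Set → Set
Finite S = ∃ λ n → Fin n ↔ S

finite-Bool : Finite Bool
finite-Bool = 2 , 2↔Bool

finite-Fin : ∀ n → Finite (Fin n)
finite-Fin n = n , ↔-refl

finite-× : ∀ {S T} → Finite S → Finite T → Finite (S × T)
finite-× (m , S↔) (n , T↔) = m * n , ↔-trans *↔× (S↔ ×-↔ T↔)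

⊤⊎↔Maybe : ∀ {S : Set} → (⊤ ⊎ S) ↔ Maybe S
⊤⊎↔Maybe = mk↔ₛ′ [ (λ _ → nothing) , just ] (maybe′ inj₂ (inj₁ tt))
  (λ { nothing → refl ; (just _) → refl }) (λ { (inj₁ tt) → refl ; (inj₂ _) → refl })

finite-Maybe : ∀ {S} → Finite S → Finite (Maybe S)
finite-Maybe (n , S↔) = suc n , ↔-trans +↔⊎ (↔-trans (1↔⊤ ⊎-↔ S↔) ⊤⊎↔Maybe)

module _ {A : Set} (M : Automaton A) (finite : Finite (Maybe (State M))) where
  open Inverse (proj₂ finite)

  toDFA : DFA A
  toDFA = record
    { nStates = proj₁ finite
    ; start   = from (just (start M))
    ; step    = λ q a → from (step? M (to q) a)
    ; final   = λ q → maybe′ (final M) false (to q)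
    }

  run-toDFA : ∀ q w → to (DFA.run toDFA q w) ≡ run M (to q) w
  run-toDFA q []      = refl
  run-toDFA q (a ∷ w) = trans (run-toDFA _ w) (cong (λ m → run M m w) (strictlyInverseˡ _))

  accepts-toDFA : ∀ w → DFA.accepts toDFA w ≡ accepts M w
  accepts-toDFA w = cong (maybe′ (final M) false)
    (trans (run-toDFA _ w) (cong (λ m → run M m w) (strictlyInverseˡ (just (start M)))))

-- The Chung-Graham automaton

-- (the next position is even, a 2 at an even position waits for a 0 at a later one)
CGState : Set
CGState = Bool × Bool

cgStep : CGState → Digit → Maybe CGState
cgStep (false , f)     0F = just (true , f)
cgStep (true  , _)     0F = just (false , false)
cgStep (true  , f)     1F = just (false , f)
cgStep (true  , false) 2F = just (false , true)
cgStep _               _  = nothing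

chungGrahamAutomaton : Automaton Digit
chungGrahamAutomaton = record
  { State = CGState
  ; start = true , false
  ; step  = cgStep
  ; final = λ _ → true
  }

CGReaches : Word → CGState → Set
CGReaches = Reaches chungGrahamAutomaton

data Transition : CGState → Digit → CGState → Set where
  odd-0  : ∀ {f} → Transition (false , f) 0F (true , f)
  even-0 : ∀ {f} → Transition (true , f) 0F (false , false)
  even-1 : ∀ {f} → Transition (true , f) 1F (false , f)
  even-2 : Transition (true , false) 2F (false , true)

transition : ∀ {s d s′} → cgStep s d ≡ just s′ → Transition s d s′
transition {false , _}    {0F} refl = odd-0
transition {true  , _}    {0F} refl = even-0
transition {true  , _}    {1F} refl = even-1
transition {true  , false} {2F} refl = even-2

Flag : Bool → Word → Set
Flag false = Settled
Flag true  = Pending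

record Invariant (w : Word) (s : CGState) : Set where
  field
    chungGraham : ChungGraham w
    parity      : proj₁ s ≡ evenᵇ (length w)
    flag        : Flag (proj₂ s) w

open Invariant

module _ {w : Word} {s : CGState} {d : Digit} {s′ : CGState} (inv : Invariant w s) where

  transition-oddZero : Transition s d s′ → Odd (length w) → toℕ d ≡ 0
  transition-oddZero odd-0  _   = refl
  transition-oddZero even-0 _   = refl
  transition-oddZero even-1 odd = contradiction (trans (parity inv) (Odd⇒evenᵇ (length w) odd)) λ ()
  transition-oddZero even-2 odd = contradiction (trans (parity inv) (Odd⇒evenᵇ (length w) odd)) λ ()

  transition-twoSeparated : Transition s d s′ → Even (length w) → toℕ d ≡ 2 → Settled w
  transition-twoSeparated odd-0  even = contradiction (trans (parity inv) (Even⇒evenᵇ (length w) even)) λ ()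
  transition-twoSeparated even-2 _ _  = flag inv

  flag-∷ʳ : ∀ f → Flag f w → toℕ d ≢ 2 → (Even (length w) → toℕ d ≢ 0) → Flag f (w ∷ʳ d)
  flag-∷ʳ false settled d≢2 _   = settled-∷ʳ {w} settled d≢2
  flag-∷ʳ true  pending _   d≢0 = pending-∷ʳ {w} pending d≢0

  transition-flag : Transition s d s′ → Flag (proj₂ s′) (w ∷ʳ d)
  transition-flag (odd-0 {f}) = flag-∷ʳ f (flag inv) (λ ())
                            λ even → contradiction (trans (parity inv) (Even⇒evenᵇ (length w) even)) λ ()
  transition-flag even-0      = settled-∷ʳ-0 {w} (evenᵇ⇒Even (length w) (sym (parity inv))) refl
  transition-flag (even-1 {f}) = flag-∷ʳ f (flag inv) (λ ()) (λ _ ())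
  transition-flag even-2      = pending-∷ʳ-2 {w} (evenᵇ⇒Even (length w) (sym (parity inv))) refl

  transition-parity : Transition s d s′ → proj₁ s′ ≡ not (proj₁ s)
  transition-parity odd-0  = refl
  transition-parity even-0 = refl
  transition-parity even-1 = refl
  transition-parity even-2 = refl

  invariant-∷ʳ : Transition s d s′ → Invariant (w ∷ʳ d) s′
  invariant-∷ʳ t = record
    { chungGraham = chungGraham-∷ʳ (chungGraham inv) (transition-oddZero t) (transition-twoSeparated t)
    ; parity      = trans (transition-parity t) (trans (cong not (parity inv)) (cong evenᵇ (sym (length-∷ʳ w d))))
    ; flag        = transition-flag t
    }

invariant-[] : Invariant [] (true , false)
invariant-[] = record
  { chungGraham = record { oddZero = λ _ () ; twoSeparated = λ _ _ _ () }
  ; parity      = refl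
  ; flag        = λ _ ()
  }

reaches-invariant : ∀ {w s} → CGReaches w s → Invariant w s
reaches-invariant []             = invariant-[]
reaches-invariant (r ∷ʳ⟨ moved ⟩) = invariant-∷ʳ (reaches-invariant r) (transition moved)

cgStep-defined : ∀ {w s d} → Invariant w s → ChungGraham (w ∷ʳ d) → ∃ λ s′ → cgStep s d ≡ just s′
cgStep-defined {s = false , _}    {0F} _ _ = _ , refl
cgStep-defined {s = true  , _}    {0F} _ _ = _ , refl
cgStep-defined {s = true  , _}    {1F} _ _ = _ , refl
cgStep-defined {s = true  , false} {2F} _ _ = _ , refl
cgStep-defined {w} {false , _} {d@(Fin.suc _)} inv cg
  with () ← chungGraham-∷ʳ-odd {w} {d} cg (evenᵇ⇒Odd (length w) (sym (parity inv)))
cgStep-defined {w} {true , true} {2F} inv cg =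
  ⊥-elim (chungGraham-∷ʳ-two {w} cg (evenᵇ⇒Even (length w) (sym (parity inv))) refl (flag inv))

chungGraham-reaches : ∀ {w} → ChungGraham w → ∃ λ s → CGReaches w s
chungGraham-reaches {w} = go (reverseView w)
  where
  go : ∀ {w} → Reverse w → ChungGraham w → ∃ λ s → CGReaches w s
  go []               _  = _ , []
  go (w ∶ view ∶ʳ d) cg with go view (chungGraham-++ˡ w (d ∷ []) cg)
  ... | s , r with cgStep-defined (reaches-invariant r) cg
  ...   | s′ , moved = s′ , r ∷ʳ⟨ moved ⟩

accepts-chungGraham : ∀ w → accepts chungGrahamAutomaton w ≡ true ⇔ ChungGraham w
accepts-chungGraham w = mk⇔
  (λ acc → let (_ , r , _) = Equivalence.to (accepts⇔reaches _ w) acc in chungGraham (reaches-invariant r))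
  (λ cg → let (s , r) = chungGraham-reaches cg in Equivalence.from (accepts⇔reaches _ w) (s , r , refl))

-- Values of Chung-Graham words

fib-mono : ∀ n → fib n ≤ fib (suc n)
fib-mono zero    = z≤n
fib-mono (suc n) = m≤m+n (fib (suc n)) (fib n)

bound : CGState → ℕ → ℕ
bound (true  , false) n = fib (suc n)
bound (true  , true)  n = fib (suc (suc n))
bound (false , false) n = fib (suc (suc n))
bound (false , true)  n = fib (suc (suc (suc n)))

bound-flag≤ : ∀ ev f n → bound (ev , f) n ≤ bound (ev , true) n
bound-flag≤ _     true  n = ≤-refl
bound-flag≤ true  false n = fib-mono (suc n)
bound-flag≤ false false n = fib-mono (suc (suc n))

bound-step : ∀ {s d s′} n V → V < bound s n → Transition s d s′ →
             V + toℕ d * fib (suc (suc n)) < bound s′ (suc n)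
bound-step n V V< (odd-0 {false}) rewrite +-identityʳ V = V<
bound-step n V V< (odd-0 {true})  rewrite +-identityʳ V = V<
bound-step n V V< (even-0 {f})    rewrite +-identityʳ V =
  <-≤-trans V< (≤-trans (bound-flag≤ true f n) (fib-mono (suc (suc n))))
bound-step n V V< (even-1 {false}) rewrite +-identityʳ (fib (suc (suc n))) =
  subst (V + X <_) (+-comm Y X) (+-monoˡ-< X V<)
  where X = fib (suc (suc n)); Y = fib (suc n)
bound-step n V V< (even-1 {true}) rewrite +-identityʳ (fib (suc (suc n))) =
  <-≤-trans (+-monoˡ-< X V<) (+-monoˡ-≤ X (m≤m+n X (fib (suc n))))
  where X = fib (suc (suc n))
bound-step n V V< even-2 rewrite +-identityʳ (fib (suc (suc n))) =
  subst (V + (X + X) <_) (trans (sym (+-assoc Y X X)) (cong (_+ X) (+-comm Y X))) (+-monoˡ-< (X + X) V<)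
  where X = fib (suc (suc n)); Y = fib (suc n)

val<bound : ∀ {w s} → CGReaches w s → val w < bound s (length w)
val<bound []                                 = s≤s z≤n
val<bound (_∷ʳ⟨_⟩ {w} {a = d} r moved) rewrite val-∷ʳ w d | length-∷ʳ w d =
  bound-step (length w) (val w) (val<bound r) (transition moved)

capacity : ℕ → ℕ
capacity n = bound (evenᵇ n , true) n

bound≤capacity : ∀ {ev} f n → ev ≡ evenᵇ n → bound (ev , f) n ≤ capacity n
bound≤capacity {ev} f n refl = bound-flag≤ ev f n

val<capacity : ∀ {w} → ChungGraham w → val w < capacity (length w)
val<capacity cg with chungGraham-reaches cg
... | (_ , f) , r = <-≤-trans (val<bound r) (bound≤capacity f _ (parity (reaches-invariant r)))

capacity-even : ∀ n → evenᵇ n ≡ true → capacity n ≡ fib (suc (suc n))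
capacity-even n even rewrite even = refl

capacity-double : ∀ n → capacity n + capacity n ≤ capacity (suc (suc n))
capacity-double n rewrite Bool.not-involutive (evenᵇ n) with evenᵇ n
... | true  = +-monoˡ-≤ (fib (suc (suc n))) (fib-mono (suc (suc n)))
... | false = +-monoˡ-≤ (fib (suc (suc (suc n)))) (fib-mono (suc (suc (suc n))))

division-unique : ∀ {F V V′} a b → V < F → V′ < F → V + a * F ≡ V′ + b * F → V ≡ V′ × a ≡ b
division-unique {F} {V} {V′} a b V<F V′<F eq = V≡V′ , *-cancelʳ-≡ a b F (+-cancelˡ-≡ V _ _ (trans eq (cong (_+ b * F) (sym V≡V′))))
  where
  instance
    F≢0 : NonZero F
    F≢0 = >-nonZero (≤-<-trans z≤n V<F)
  open ≡-Reasoning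
  V≡V′ : V ≡ V′
  V≡V′ = begin
    V                ≡⟨ m<n⇒m%n≡m V<F ⟨
    V % F            ≡⟨ [m+kn]%n≡m%n V a F ⟨
    (V + a * F) % F  ≡⟨ cong (_% F) eq ⟩
    (V′ + b * F) % F ≡⟨ [m+kn]%n≡m%n V′ b F ⟩
    V′ % F           ≡⟨ m<n⇒m%n≡m V′<F ⟩
    V′               ∎

data LastDigit : Bool → ℕ → ℕ → Digit → Set where
  at-odd  : ∀ {n V} → LastDigit false n V 0F
  at-even : ∀ {n V d} → V < fib (suc (suc n)) → LastDigit true n V d

last-digit : ∀ {w s d s′} → CGReaches w s → Transition s d s′ → LastDigit (proj₁ s) (length w) (val w) d
last-digit     r odd-0        = at-odd
last-digit {w} r (even-0 {f}) = at-even (<-≤-trans (val<bound r) (bound-flag≤ true f (length w)))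
last-digit {w} r (even-1 {f}) = at-even (<-≤-trans (val<bound r) (bound-flag≤ true f (length w)))
last-digit {w} r even-2       = at-even (<-≤-trans (val<bound r) (bound-flag≤ true false (length w)))

last-digit-unique : ∀ {ev n V V′ d d′} → LastDigit ev n V d → LastDigit ev n V′ d′ →
                    V + toℕ d * fib (suc (suc n)) ≡ V′ + toℕ d′ * fib (suc (suc n)) → V ≡ V′ × d ≡ d′
last-digit-unique {V = V} {V′} at-odd at-odd eq = trans (sym (+-identityʳ V)) (trans eq (+-identityʳ V′)) , refl
last-digit-unique {d = d} {d′} (at-even V<) (at-even V′<) eq with division-unique (toℕ d) (toℕ d′) V< V′< eq
... | V≡V′ , d≡d′ = V≡V′ , toℕ-injective d≡d′

reaches-injective : ∀ {w w′ s s′} → CGReaches w s → CGReaches w′ s′ →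
                    length w ≡ length w′ → val w ≡ val w′ → w ≡ w′
reaches-injective [] [] _ _ = refl
reaches-injective [] (_∷ʳ⟨_⟩ {w′} {a = d′} _ _) len _ = contradiction (trans len (length-∷ʳ w′ d′)) λ ()
reaches-injective (_∷ʳ⟨_⟩ {w} {a = d} _ _) [] len _ = contradiction (trans (sym (length-∷ʳ w d)) len) λ ()
reaches-injective (_∷ʳ⟨_⟩ {w} {s₀} {d} r moved) (_∷ʳ⟨_⟩ {w′} {s₀′} {d′} r′ moved′) len eq =
  cong₂ _∷ʳ_ (reaches-injective r r′ len′ (proj₁ unique)) (proj₂ unique)
  where
  len′ : length w ≡ length w′
  len′ = suc-injective (trans (sym (length-∷ʳ w d)) (trans len (length-∷ʳ w′ d′)))

  same-parity : proj₁ s₀′ ≡ proj₁ s₀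
  same-parity = trans (parity (reaches-invariant r′)) (trans (cong evenᵇ (sym len′)) (sym (parity (reaches-invariant r))))

  unique : val w ≡ val w′ × d ≡ d′
  unique = last-digit-unique (last-digit r (transition moved))
    (subst₂ (λ ev n → LastDigit ev n (val w′) d′) same-parity (sym len′) (last-digit r′ (transition moved′)))
    (trans (sym (val-∷ʳ w d)) (trans eq (trans (val-∷ʳ w′ d′)
      (cong (λ n → val w′ + toℕ d′ * fib (suc (suc n))) (sym len′)))))

val-injective : ∀ {w w′} → ChungGraham w → ChungGraham w′ → length w ≡ length w′ → val w ≡ val w′ → w ≡ w′
val-injective cg cg′ = reaches-injective (proj₂ (chungGraham-reaches cg)) (proj₂ (chungGraham-reaches cg′))

Representation : ℕ → CGState → ℕ → Set
Representation n (ev , f) N = ∃ λ w → length w ≡ n × val w ≡ N × ∃ λ f′ → f′ Bool.≤ f × CGReaches w (ev , f′)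

append-digit : ∀ {n ev f g N} d → Representation n (ev , f) N →
               (∀ {f′} → f′ Bool.≤ f → ∃ λ f″ → f″ Bool.≤ g × cgStep (ev , f′) d ≡ just (not ev , f″)) →
               Representation (suc n) (not ev , g) (N + toℕ d * fib (suc (suc n)))
append-digit d (w , refl , refl , f′ , f′≤f , r) extend with extend f′≤f
... | f″ , f″≤g , eq = w ∷ʳ d , length-∷ʳ w d , val-∷ʳ w d , f″ , f″≤g , r ∷ʳ⟨ eq ⟩

bound-odd : ∀ f n → bound (true , f) (suc n) ≡ bound (false , f) n
bound-odd false n = refl
bound-odd true  n = refl

m<n+o⇒m∸n<o′ : ∀ {N X Y} → X ≤ N → N < X + Y → N ∸ X < Y
m<n+o⇒m∸n<o′ {N} {X} X≤N N< = +-cancelˡ-< X _ _ (subst (_< X + _) (sym (m+[n∸m]≡n X≤N)) N<)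

module _ (n : ℕ) (rep : ∀ f N → N < bound (true , f) n → Representation n (true , f) N) where
  private
    X : ℕ
    X = fib (suc (suc n))

  representation-top-two : ∀ f N → N < bound (false , f) (suc n) → X ≤ N → bound (true , f) n ≤ N ∸ X →
                           Representation (suc n) (false , f) N
  representation-top-two false N N< X≤N Y≤M = contradiction (m<n+o⇒m∸n<o′ X≤N N<) (≤⇒≯ Y≤M)
  representation-top-two true  N N< X≤N X≤M =
    subst (Representation (suc n) (false , true)) value
      (append-digit 2F (rep false K K<) λ { b≤b → true , b≤b , refl })
    where
    K : ℕ
    K = (N ∸ X) ∸ X
    K< : K < fib (suc n)
    K< = m<n+o⇒m∸n<o′ X≤M (m<n+o⇒m∸n<o′ X≤N (subst (N <_) (+-comm _ X) N<))
    value : K + 2 * X ≡ N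
    value rewrite +-identityʳ X =
      trans (sym (+-assoc K X X)) (trans (cong (_+ X) (m∸n+n≡m X≤M)) (m∸n+n≡m X≤N))

  representation-even : ∀ f N → N < bound (false , f) (suc n) → Representation (suc n) (false , f) N
  representation-even f N N< with N <? X
  ... | yes N<X = subst (Representation (suc n) (false , f)) (+-identityʳ N)
                    (append-digit 0F (rep true N N<X) λ _ → false , Bool.≤-minimum f , refl)
  ... | no N≮X with N ∸ X <? bound (true , f) n
  ...   | yes M< = subst (Representation (suc n) (false , f))
                     (trans (cong (_+_ (N ∸ X)) (+-identityʳ X)) (m∸n+n≡m (≮⇒≥ N≮X)))
                     (append-digit 1F (rep f (N ∸ X) M<) λ f′≤f → _ , f′≤f , refl)
  ...   | no M≮ = representation-top-two f N N< (≮⇒≥ N≮X) (≮⇒≥ M≮)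

representation-odd : ∀ n → (∀ f N → N < bound (false , f) n → Representation n (false , f) N) →
                     ∀ f N → N < bound (true , f) (suc n) → Representation (suc n) (true , f) N
representation-odd n rep f N N< =
  subst (Representation (suc n) (true , f)) (+-identityʳ N)
    (append-digit 0F (rep f N (subst (N <_) (bound-odd f n) N<)) λ f′≤f → _ , f′≤f , refl)

representation : ∀ n f N → N < bound (evenᵇ n , f) n → Representation n (evenᵇ n , f) N
representation zero    f     zero    _         = [] , refl , refl , false , Bool.≤-minimum f , []
representation zero    false (suc N) (s≤s ())
representation zero    true  (suc N) (s≤s ())
representation (suc n) f N N< with evenᵇ n | representation n
... | true  | rep = representation-even n rep f N N<
... | false | rep = representation-odd n rep f N N<

chungGraham-representation : ∀ n N → N < capacity n → ∃ λ w → length w ≡ n × ChungGraham w × val w ≡ N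
chungGraham-representation n N N< with representation n true N N<
... | w , len , v , _ , _ , r = w , len , chungGraham (reaches-invariant r) , v

-- Carries

excess : Letter3 → ℤ
excess (x , y , z) = (+ toℕ x ℤ.+ + toℕ y) ℤ.- + toℕ z

excessFrom : ℕ → List Letter3 → ℤ
excessFrom i []      = 0ℤ
excessFrom i (l ∷ w) = excess l ℤ.* + fib (suc (suc i)) ℤ.+ excessFrom (suc i) w

excessFrom-++ : ∀ i u v → excessFrom i (u ++ v) ≡ excessFrom i u ℤ.+ excessFrom (i + length u) v
excessFrom-++ i []      v rewrite +-identityʳ i = sym (ℤ.+-identityˡ _)
excessFrom-++ i (l ∷ u) v rewrite excessFrom-++ (suc i) u v | +-suc i (length u) =
  sym (ℤ.+-assoc (excess l ℤ.* + fib (suc (suc i))) (excessFrom (suc i) u) (excessFrom (suc (i + length u)) v))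

+valFrom-∷ : ∀ i d t → + valFrom i (d ∷ t) ≡ + toℕ d ℤ.* + fib (suc (suc i)) ℤ.+ + valFrom (suc i) t
+valFrom-∷ i d t = begin
  + (toℕ d * fib (i + 2) + V)             ≡⟨ ℤ.pos-+ (toℕ d * fib (i + 2)) V ⟩
  + (toℕ d * fib (i + 2)) ℤ.+ + V         ≡⟨ cong (ℤ._+ + V) (ℤ.pos-* (toℕ d) (fib (i + 2))) ⟩
  + toℕ d ℤ.* + fib (i + 2) ℤ.+ + V       ≡⟨ cong (λ n → + toℕ d ℤ.* + fib n ℤ.+ + V) (+-comm i 2) ⟩
  + toℕ d ℤ.* + fib (suc (suc i)) ℤ.+ + V ∎
  where
  V : ℕ
  V = valFrom (suc i) t
  open ≡-Reasoning

excess-distrib : ∀ x y z F X Y Z →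
  ((x ℤ.* F ℤ.+ X) ℤ.+ (y ℤ.* F ℤ.+ Y)) ℤ.- (z ℤ.* F ℤ.+ Z) ≡ ((x ℤ.+ y) ℤ.- z) ℤ.* F ℤ.+ ((X ℤ.+ Y) ℤ.- Z)
excess-distrib = solve-∀

excessFrom-val : ∀ i w → excessFrom i w ≡ (+ valFrom i (track₁ w) ℤ.+ + valFrom i (track₂ w)) ℤ.- + valFrom i (track₃ w)
excessFrom-val i [] = refl
excessFrom-val i ((x , y , z) ∷ w) = begin
  excess (x , y , z) ℤ.* F ℤ.+ excessFrom (suc i) w
    ≡⟨ cong (ℤ._+_ (excess (x , y , z) ℤ.* F)) (excessFrom-val (suc i) w) ⟩
  excess (x , y , z) ℤ.* F ℤ.+ ((X ℤ.+ Y) ℤ.- Z)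
    ≡⟨ excess-distrib (+ toℕ x) (+ toℕ y) (+ toℕ z) F X Y Z ⟨
  ((+ toℕ x ℤ.* F ℤ.+ X) ℤ.+ (+ toℕ y ℤ.* F ℤ.+ Y)) ℤ.- (+ toℕ z ℤ.* F ℤ.+ Z)
    ≡⟨ cong₂ ℤ._-_ (cong₂ ℤ._+_ (+valFrom-∷ i x (track₁ w)) (+valFrom-∷ i y (track₂ w))) (+valFrom-∷ i z (track₃ w)) ⟨
  (+ valFrom i (x ∷ track₁ w) ℤ.+ + valFrom i (y ∷ track₂ w)) ℤ.- + valFrom i (z ∷ track₃ w) ∎
  where
  F X Y Z : ℤ
  F = + fib (suc (suc i))
  X = + valFrom (suc i) (track₁ w)
  Y = + valFrom (suc i) (track₂ w)
  Z = + valFrom (suc i) (track₃ w)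
  open ≡-Reasoning

sum⇔excess : ∀ w → val (track₁ w) + val (track₂ w) ≡ val (track₃ w) ⇔ excessFrom 0 w ≡ 0ℤ
sum⇔excess w = mk⇔ to from
  where
  x y z : ℕ
  x = val (track₁ w)
  y = val (track₂ w)
  z = val (track₃ w)

  to : x + y ≡ z → excessFrom 0 w ≡ 0ℤ
  to sum = begin
    excessFrom 0 w              ≡⟨ excessFrom-val 0 w ⟩
    (+ x ℤ.+ + y) ℤ.- + z       ≡⟨ cong (ℤ._- + z) (ℤ.pos-+ x y) ⟨
    + (x + y) ℤ.- + z           ≡⟨ cong (λ n → + n ℤ.- + z) sum ⟩
    + z ℤ.- + z                 ≡⟨ ℤ.+-inverseʳ (+ z) ⟩
    0ℤ                          ∎
    where open ≡-Reasoning

  from : excessFrom 0 w ≡ 0ℤ → x + y ≡ z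
  from balanced = ℤ.+-injective (trans (ℤ.pos-+ x y)
    (ℤ.i-j≡0⇒i≡j (+ x ℤ.+ + y) (+ z) (trans (sym (excessFrom-val 0 w)) balanced)))

pairValue : ℕ → ℤ × ℤ → ℤ
pairValue n (a , b) = a ℤ.* + fib (suc (suc n)) ℤ.+ b ℤ.* + fib (suc n)

advance : ℤ × ℤ → ℤ → ℤ × ℤ
advance (a , b) e = b , (a ℤ.- b) ℤ.- e

retreat : ℤ × ℤ → ℤ → ℤ × ℤ
retreat (a , b) e = (a ℤ.+ b) ℤ.+ e , a

advance-retreat-identity : ∀ a b e → ((a ℤ.+ b) ℤ.+ e ℤ.- a) ℤ.- e ≡ b
advance-retreat-identity = solve-∀

advance-retreat : ∀ p e → advance (retreat p e) e ≡ p
advance-retreat (a , b) e = cong (a ,_) (advance-retreat-identity a b e)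

pairValue-advance-identity : ∀ a b e F₂ F₁ →
  a ℤ.* F₂ ℤ.+ b ℤ.* F₁ ≡ e ℤ.* F₂ ℤ.+ (b ℤ.* (F₂ ℤ.+ F₁) ℤ.+ ((a ℤ.- b) ℤ.- e) ℤ.* F₂)
pairValue-advance-identity = solve-∀

pairValue-advance : ∀ n p e → pairValue n p ≡ e ℤ.* + fib (suc (suc n)) ℤ.+ pairValue (suc n) (advance p e)
pairValue-advance n (a , b) e = trans (pairValue-advance-identity a b e F₂ F₁)
  (cong (λ F₃ → e ℤ.* F₂ ℤ.+ (b ℤ.* F₃ ℤ.+ ((a ℤ.- b) ℤ.- e) ℤ.* F₂)) (sym (ℤ.pos-+ (fib (suc (suc n))) (fib (suc n)))))
  where
  F₂ F₁ : ℤ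
  F₂ = + fib (suc (suc n))
  F₁ = + fib (suc n)

carry : List Letter3 → ℤ × ℤ
carry []      = 0ℤ , 0ℤ
carry (l ∷ v) = retreat (carry v) (excess l)

excessFrom-carry : ∀ n v → excessFrom n v ≡ pairValue n (carry v)
excessFrom-carry n []      = refl
excessFrom-carry n (l ∷ v) = begin
  e ℤ.* F ℤ.+ excessFrom (suc n) v                                   ≡⟨ cong (ℤ._+_ (e ℤ.* F)) (excessFrom-carry (suc n) v) ⟩
  e ℤ.* F ℤ.+ pairValue (suc n) (carry v)                            ≡⟨ cong (λ p → e ℤ.* F ℤ.+ pairValue (suc n) p) (advance-retreat (carry v) e) ⟨
  e ℤ.* F ℤ.+ pairValue (suc n) (advance (retreat (carry v) e) e)    ≡⟨ pairValue-advance n (retreat (carry v) e) e ⟨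
  pairValue n (retreat (carry v) e)                                  ∎
  where
  e F : ℤ
  e = excess l
  F = + fib (suc (suc n))
  open ≡-Reasoning

-- The carries at the even (odd) positions of a word satisfying CGSum:
-- evenCarry-from-band cuts the even ones down to these eight, and the odd ones are
-- their images under retreat _ 0ℤ.
data EvenCarry : ℤ × ℤ → Set where
  ⟨-1,-1⟩ : EvenCarry (-[1+ 0 ] , -[1+ 0 ])
  ⟨-1,0⟩  : EvenCarry (-[1+ 0 ] , + 0)
  ⟨0,-2⟩  : EvenCarry (+ 0 , -[1+ 1 ])
  ⟨0,-1⟩  : EvenCarry (+ 0 , -[1+ 0 ])
  ⟨0,0⟩   : EvenCarry (+ 0 , + 0)
  ⟨1,-2⟩  : EvenCarry (+ 1 , -[1+ 1 ])
  ⟨1,-1⟩  : EvenCarry (+ 1 , -[1+ 0 ])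
  ⟨2,-2⟩  : EvenCarry (+ 2 , -[1+ 1 ])

data OddCarry : ℤ × ℤ → Set where
  ⟨-2,-1⟩ : OddCarry (-[1+ 1 ] , -[1+ 0 ])
  ⟨-2,0⟩  : OddCarry (-[1+ 1 ] , + 0)
  ⟨-1,-1⟩ : OddCarry (-[1+ 0 ] , -[1+ 0 ])
  ⟨-1,0⟩  : OddCarry (-[1+ 0 ] , + 0)
  ⟨-1,1⟩  : OddCarry (-[1+ 0 ] , + 1)
  ⟨0,0⟩   : OddCarry (+ 0 , + 0)
  ⟨0,1⟩   : OddCarry (+ 0 , + 1)
  ⟨0,2⟩   : OddCarry (+ 0 , + 2)

Band : ℤ → ℤ → Set
Band F T = ℤ.- (F ℤ.+ F) ℤ.< T × T ℤ.< F

nonNeg-* : ∀ {x y} → 0ℤ ℤ.≤ x → 0ℤ ℤ.≤ y → 0ℤ ℤ.≤ x ℤ.* y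
nonNeg-* {+ m} {+ n} _ _ = subst (0ℤ ℤ.≤_) (ℤ.pos-* m n) (+≤+ z≤n)

nonNeg-combination : ∀ {x y X Y} → 0ℤ ℤ.≤ x → 0ℤ ℤ.≤ y → 0ℤ ℤ.≤ X → 0ℤ ℤ.≤ Y → 0ℤ ℤ.≤ x ℤ.* X ℤ.+ y ℤ.* Y
nonNeg-combination x≥0 y≥0 X≥0 Y≥0 = ℤ.+-mono-≤ (nonNeg-* x≥0 X≥0) (nonNeg-* y≥0 Y≥0)

above-band : ∀ c d a b → (c ℤ.* (a ℤ.+ b) ℤ.+ d ℤ.* a) ℤ.- (a ℤ.+ b) ≡ ((c ℤ.+ d) ℤ.- 1ℤ) ℤ.* a ℤ.+ (c ℤ.- 1ℤ) ℤ.* b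
above-band = solve-∀

below-band : ∀ c d a b → ℤ.- ((a ℤ.+ b) ℤ.+ (a ℤ.+ b)) ℤ.- (c ℤ.* (a ℤ.+ b) ℤ.+ d ℤ.* a)
                         ≡ ((ℤ.- c) ℤ.- + 2) ℤ.* (a ℤ.+ b) ℤ.+ (ℤ.- d) ℤ.* a
below-band = solve-∀

below-band′ : ∀ d a b → ℤ.- ((a ℤ.+ b) ℤ.+ (a ℤ.+ b)) ℤ.- ((ℤ.- 1ℤ) ℤ.* (a ℤ.+ b) ℤ.+ d ℤ.* a)
                        ≡ ((ℤ.- d) ℤ.- + 2) ℤ.* a ℤ.+ 1ℤ ℤ.* (a ℤ.- b)
below-band′ = solve-∀

module _ {a b : ℤ} (0≤b : 0ℤ ℤ.≤ b) (b≤a : b ℤ.≤ a) where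
  private
    0≤a : 0ℤ ℤ.≤ a
    0≤a = ℤ.≤-trans 0≤b b≤a

  too-large : ∀ c d → 0ℤ ℤ.≤ c ℤ.- 1ℤ → 0ℤ ℤ.≤ (c ℤ.+ d) ℤ.- 1ℤ → ¬ Band (a ℤ.+ b) (c ℤ.* (a ℤ.+ b) ℤ.+ d ℤ.* a)
  too-large c d c≥1 c+d≥1 (_ , upper) = ℤ.<⇒≱ upper (ℤ.0≤i-j⇒j≤i
    (subst (0ℤ ℤ.≤_) (sym (above-band c d a b)) (nonNeg-combination c+d≥1 c≥1 0≤a 0≤b)))

  too-small : ∀ c d → 0ℤ ℤ.≤ (ℤ.- c) ℤ.- + 2 → 0ℤ ℤ.≤ ℤ.- d → ¬ Band (a ℤ.+ b) (c ℤ.* (a ℤ.+ b) ℤ.+ d ℤ.* a)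
  too-small c d c≤-2 d≤0 (lower , _) = ℤ.<⇒≱ lower (ℤ.0≤i-j⇒j≤i
    (subst (0ℤ ℤ.≤_) (sym (below-band c d a b)) (nonNeg-combination c≤-2 d≤0 (ℤ.+-mono-≤ 0≤a 0≤b) 0≤a)))

  too-small′ : ∀ d → 0ℤ ℤ.≤ (ℤ.- d) ℤ.- + 2 → ¬ Band (a ℤ.+ b) ((ℤ.- 1ℤ) ℤ.* (a ℤ.+ b) ℤ.+ d ℤ.* a)
  too-small′ d d≤-2 (lower , _) = ℤ.<⇒≱ lower (ℤ.0≤i-j⇒j≤i
    (subst (0ℤ ℤ.≤_) (sym (below-band′ d a b)) (nonNeg-combination {y = 1ℤ} d≤-2 (+≤+ z≤n) 0≤a (ℤ.i≤j⇒0≤j-i b≤a))))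

  evenCarry-from-band : ∀ c d → -[1+ 1 ] ℤ.≤ d → d ℤ.≤ 0ℤ →
                        Band (a ℤ.+ b) (c ℤ.* (a ℤ.+ b) ℤ.+ d ℤ.* a) → EvenCarry (c , d)
  evenCarry-from-band c (+ suc _)           _                  (+≤+ ())
  evenCarry-from-band c -[1+ suc (suc _) ] (-≤- (s≤s ())) _
  evenCarry-from-band -[1+ suc k ] d _ d≤0 band = ⊥-elim (too-small -[1+ suc k ] d (+≤+ z≤n) (ℤ.neg-mono-≤ d≤0) band)
  evenCarry-from-band -[1+ 0 ]  (+ 0)    _ _ _    = ⟨-1,0⟩
  evenCarry-from-band (+ 0)     (+ 0)    _ _ _    = ⟨0,0⟩
  evenCarry-from-band (+ suc k) (+ 0)    _ _ band = ⊥-elim (too-large (+ suc k) (+ 0) (+≤+ z≤n) (+≤+ z≤n) band)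
  evenCarry-from-band -[1+ 0 ]  -[1+ 0 ] _ _ _    = ⟨-1,-1⟩
  evenCarry-from-band (+ 0)     -[1+ 0 ] _ _ _    = ⟨0,-1⟩
  evenCarry-from-band (+ 1)     -[1+ 0 ] _ _ _    = ⟨1,-1⟩
  evenCarry-from-band (+ suc (suc k)) -[1+ 0 ] _ _ band =
    ⊥-elim (too-large (+ suc (suc k)) -[1+ 0 ] (+≤+ z≤n) (+≤+ z≤n) band)
  evenCarry-from-band -[1+ 0 ]  -[1+ 1 ] _ _ band = ⊥-elim (too-small′ -[1+ 1 ] (+≤+ z≤n) band)
  evenCarry-from-band (+ 0)     -[1+ 1 ] _ _ _    = ⟨0,-2⟩
  evenCarry-from-band (+ 1)     -[1+ 1 ] _ _ _    = ⟨1,-2⟩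
  evenCarry-from-band (+ 2)     -[1+ 1 ] _ _ _    = ⟨2,-2⟩
  evenCarry-from-band (+ suc (suc (suc k))) -[1+ 1 ] _ _ band =
    ⊥-elim (too-large (+ suc (suc (suc k))) -[1+ 1 ] (+≤+ z≤n) (+≤+ z≤n) band)

toℤ₅ : Fin 5 → ℤ
toℤ₅ k = + toℕ k ℤ.- + 2

fromℤ₅ : ℤ → Maybe (Fin 5)
fromℤ₅ -[1+ 1 ] = just 0F
fromℤ₅ -[1+ 0 ] = just 1F
fromℤ₅ (+ 0)    = just 2F
fromℤ₅ (+ 1)    = just 3F
fromℤ₅ (+ 2)    = just 4F
fromℤ₅ _        = nothing

toℤ₅-fromℤ₅ : ∀ a {k} → fromℤ₅ a ≡ just k → toℤ₅ k ≡ a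
toℤ₅-fromℤ₅ -[1+ 1 ] refl = refl
toℤ₅-fromℤ₅ -[1+ 0 ] refl = refl
toℤ₅-fromℤ₅ (+ 0)    refl = refl
toℤ₅-fromℤ₅ (+ 1)    refl = refl
toℤ₅-fromℤ₅ (+ 2)    refl = refl

decodePair : Fin 5 × Fin 5 → ℤ × ℤ
decodePair (p , q) = toℤ₅ p , toℤ₅ q

encodePair : ℤ × ℤ → Maybe (Fin 5 × Fin 5)
encodePair (a , b) = zip (fromℤ₅ a) (fromℤ₅ b)

decodePair-encodePair : ∀ c {k} → encodePair c ≡ just k → decodePair k ≡ c
decodePair-encodePair (a , b) eq with fromℤ₅ a in ea | fromℤ₅ b in eb
decodePair-encodePair (a , b) refl | just _ | just _ = cong₂ _,_ (toℤ₅-fromℤ₅ a ea) (toℤ₅-fromℤ₅ b eb)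

CarryRange : Bool → ℤ × ℤ → Set
CarryRange true  = EvenCarry
CarryRange false = OddCarry

carryRange-zero : ∀ p → CarryRange p (0ℤ , 0ℤ)
carryRange-zero true  = ⟨0,0⟩
carryRange-zero false = ⟨0,0⟩

carryRange-encodable : ∀ p {c} → CarryRange p c → ∃ λ k → encodePair c ≡ just k
carryRange-encodable true  ⟨-1,-1⟩ = _ , refl
carryRange-encodable true  ⟨-1,0⟩  = _ , refl
carryRange-encodable true  ⟨0,-2⟩  = _ , refl
carryRange-encodable true  ⟨0,-1⟩  = _ , refl
carryRange-encodable true  ⟨0,0⟩   = _ , refl
carryRange-encodable true  ⟨1,-2⟩  = _ , refl
carryRange-encodable true  ⟨1,-1⟩  = _ , refl
carryRange-encodable true  ⟨2,-2⟩  = _ , refl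
carryRange-encodable false ⟨-2,-1⟩ = _ , refl
carryRange-encodable false ⟨-2,0⟩  = _ , refl
carryRange-encodable false ⟨-1,-1⟩ = _ , refl
carryRange-encodable false ⟨-1,0⟩  = _ , refl
carryRange-encodable false ⟨-1,1⟩  = _ , refl
carryRange-encodable false ⟨0,0⟩   = _ , refl
carryRange-encodable false ⟨0,1⟩   = _ , refl
carryRange-encodable false ⟨0,2⟩   = _ , refl

oddCarry-retreat : ∀ {p} → EvenCarry p → OddCarry (retreat p 0ℤ)
oddCarry-retreat ⟨-1,-1⟩ = ⟨-2,-1⟩
oddCarry-retreat ⟨-1,0⟩  = ⟨-1,-1⟩
oddCarry-retreat ⟨0,-2⟩  = ⟨-2,0⟩
oddCarry-retreat ⟨0,-1⟩  = ⟨-1,0⟩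
oddCarry-retreat ⟨0,0⟩   = ⟨0,0⟩
oddCarry-retreat ⟨1,-2⟩  = ⟨-1,1⟩
oddCarry-retreat ⟨1,-1⟩  = ⟨0,1⟩
oddCarry-retreat ⟨2,-2⟩  = ⟨0,2⟩

oddCarry-bounds : ∀ {a b} → OddCarry (a , b) → -[1+ 1 ] ℤ.≤ a × a ℤ.≤ 0ℤ
oddCarry-bounds ⟨-2,-1⟩ = -≤- (s≤s z≤n) , -≤+
oddCarry-bounds ⟨-2,0⟩  = -≤- (s≤s z≤n) , -≤+
oddCarry-bounds ⟨-1,-1⟩ = -≤- z≤n , -≤+
oddCarry-bounds ⟨-1,0⟩  = -≤- z≤n , -≤+
oddCarry-bounds ⟨-1,1⟩  = -≤- z≤n , -≤+
oddCarry-bounds ⟨0,0⟩   = -≤+ , +≤+ z≤n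
oddCarry-bounds ⟨0,1⟩   = -≤+ , +≤+ z≤n
oddCarry-bounds ⟨0,2⟩   = -≤+ , +≤+ z≤n

evenCarry-retreat : ∀ n {p} e → OddCarry p → Band (+ fib (suc (suc n))) (pairValue n (retreat p e)) →
                    EvenCarry (retreat p e)
evenCarry-retreat n {a , b} e range band =
  evenCarry-from-band (+≤+ z≤n) (+≤+ (fib-mono n)) c a (proj₁ (oddCarry-bounds range)) (proj₂ (oddCarry-bounds range))
    (subst₂ Band F≡ (cong (λ F → c ℤ.* F ℤ.+ a ℤ.* + fib (suc n)) F≡) band)
  where
  c : ℤ
  c = (a ℤ.+ b) ℤ.+ e
  F≡ : + fib (suc (suc n)) ≡ + fib (suc n) ℤ.+ + fib n
  F≡ = ℤ.pos-+ (fib (suc n)) (fib n)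

-- An odd carry (a, b) has a ≤ b ≤ a + 2, so it is determined by 2a + b as a = ⌊(2a + b)/3⌋.
initialCarry : ℤ → ℤ × ℤ
initialCarry e = a , (ℤ.- e) ℤ.- (a ℤ.+ a)
  where a = (ℤ.- e) ℤ./ℕ 3

initialCarry-inverts : ∀ {a b} → OddCarry (a , b) → initialCarry (ℤ.- ((a ℤ.+ a) ℤ.+ b)) ≡ (a , b)
initialCarry-inverts ⟨-2,-1⟩ = refl
initialCarry-inverts ⟨-2,0⟩  = refl
initialCarry-inverts ⟨-1,-1⟩ = refl
initialCarry-inverts ⟨-1,0⟩  = refl
initialCarry-inverts ⟨-1,1⟩  = refl
initialCarry-inverts ⟨0,0⟩   = refl
initialCarry-inverts ⟨0,1⟩   = refl
initialCarry-inverts ⟨0,2⟩   = refl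

retreat-balance-identity : ∀ a b e → ((a ℤ.+ b) ℤ.+ e) ℤ.* 1ℤ ℤ.+ a ℤ.* 1ℤ ≡ e ℤ.+ ((a ℤ.+ a) ℤ.+ b)
retreat-balance-identity = solve-∀

+-minus-identity : ∀ i j → i ≡ (i ℤ.+ j) ℤ.- j
+-minus-identity = solve-∀

+≡0⇒≡- : ∀ i j → i ℤ.+ j ≡ 0ℤ → i ≡ ℤ.- j
+≡0⇒≡- i j i+j≡0 = trans (+-minus-identity i j) (trans (cong (ℤ._- j) i+j≡0) (ℤ.+-identityˡ (ℤ.- j)))

initialCarry-retreat : ∀ p e → OddCarry p → pairValue 0 (retreat p e) ≡ 0ℤ → initialCarry e ≡ p
initialCarry-retreat (a , b) e range balanced =
  subst (λ e → initialCarry e ≡ (a , b))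
    (sym (+≡0⇒≡- e ((a ℤ.+ a) ℤ.+ b) (trans (sym (retreat-balance-identity a b e)) balanced)))
    (initialCarry-inverts range)

-- fresh: nothing read yet; pair k: the carry decodePair k of the unread suffix.
CarryState : Set
CarryState = Maybe (Fin 5 × Fin 5)

pattern fresh  = nothing
pattern pair k = just k

nextCarry : CarryState → ℤ → ℤ × ℤ
nextCarry fresh    e = initialCarry e
nextCarry (pair k) e = advance (decodePair k) e

carryStep : CarryState → Letter3 → Maybe CarryState
carryStep c l = Maybe.map just (encodePair (nextCarry c (excess l)))

carryFinal : CarryState → Bool
carryFinal fresh    = true
carryFinal (pair k) = does (≡-dec ℤ._≟_ ℤ._≟_ (decodePair k) (0ℤ , 0ℤ))

carryAutomaton : Automaton Letter3
carryAutomaton = record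
  { State = CarryState
  ; start = fresh
  ; step  = carryStep
  ; final = carryFinal
  }

carryStep-inversion : ∀ c l {c′} → carryStep c l ≡ just c′ → ∃ λ k → c′ ≡ pair k × decodePair k ≡ nextCarry c (excess l)
carryStep-inversion c l eq with encodePair (nextCarry c (excess l)) in encoded
carryStep-inversion c l refl | just k = k , refl , decodePair-encodePair _ encoded

CarryInvariant : List Letter3 → CarryState → Set
CarryInvariant u fresh    = u ≡ []
CarryInvariant u (pair k) = excessFrom 0 u ℤ.+ pairValue (length u) (decodePair k) ≡ 0ℤ

initialCarry-balance : ∀ e a → (e ℤ.* 1ℤ ℤ.+ 0ℤ) ℤ.+ (a ℤ.* + 2 ℤ.+ ((ℤ.- e) ℤ.- (a ℤ.+ a)) ℤ.* 1ℤ) ≡ 0ℤ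
initialCarry-balance = solve-∀

excessFrom-∷ʳ : ∀ u l → excessFrom 0 (u ∷ʳ l) ≡ excessFrom 0 u ℤ.+ excess l ℤ.* + fib (suc (suc (length u)))
excessFrom-∷ʳ u l = trans (excessFrom-++ 0 u (l ∷ [])) (cong (ℤ._+_ (excessFrom 0 u)) (ℤ.+-identityʳ _))

carryInvariant-∷ʳ : ∀ {u c k} l → CarryInvariant u c → decodePair k ≡ nextCarry c (excess l) →
                    CarryInvariant (u ∷ʳ l) (pair k)
carryInvariant-∷ʳ {c = fresh} l refl decoded =
  subst (λ p → excessFrom 0 (l ∷ []) ℤ.+ pairValue 1 p ≡ 0ℤ) (sym decoded)
    (initialCarry-balance (excess l) ((ℤ.- excess l) ℤ./ℕ 3))
carryInvariant-∷ʳ {u} {pair k₀} {k} l balanced decoded = begin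
  excessFrom 0 (u ∷ʳ l) ℤ.+ pairValue (length (u ∷ʳ l)) (decodePair k)
    ≡⟨ cong₂ (λ E n → E ℤ.+ pairValue n (decodePair k)) (excessFrom-∷ʳ u l) (length-∷ʳ u l) ⟩
  (X ℤ.+ e ℤ.* F) ℤ.+ pairValue (suc (length u)) (decodePair k)
    ≡⟨ ℤ.+-assoc X (e ℤ.* F) _ ⟩
  X ℤ.+ (e ℤ.* F ℤ.+ pairValue (suc (length u)) (decodePair k))
    ≡⟨ cong (λ p → X ℤ.+ (e ℤ.* F ℤ.+ pairValue (suc (length u)) p)) decoded ⟩
  X ℤ.+ (e ℤ.* F ℤ.+ pairValue (suc (length u)) (advance (decodePair k₀) e))
    ≡⟨ cong (ℤ._+_ X) (pairValue-advance (length u) (decodePair k₀) e) ⟨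
  X ℤ.+ pairValue (length u) (decodePair k₀)
    ≡⟨ balanced ⟩
  0ℤ ∎
  where
  X e F : ℤ
  X = excessFrom 0 u
  e = excess l
  F = + fib (suc (suc (length u)))
  open ≡-Reasoning

carryInvariant : ∀ {u c} → Reaches carryAutomaton u c → CarryInvariant u c
carryInvariant []                                = refl
carryInvariant (_∷ʳ⟨_⟩ {s = c} {a = l} r moved) with carryStep-inversion c l moved
... | k , refl , decoded = carryInvariant-∷ʳ {k = k} l (carryInvariant r) decoded

carry-sound : ∀ w → accepts carryAutomaton w ≡ true → excessFrom 0 w ≡ 0ℤ
carry-sound w acc with Equivalence.to (accepts⇔reaches carryAutomaton w) acc
... | fresh  , r , _   with refl ← carryInvariant r = refl
... | pair k , r , fin with ≡-dec ℤ._≟_ ℤ._≟_ (decodePair k) (0ℤ , 0ℤ) | carryInvariant r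
...   | yes vanishing | balanced =
  trans (sym (ℤ.+-identityʳ _)) (subst (λ p → excessFrom 0 w ℤ.+ pairValue (length w) p ≡ 0ℤ) vanishing balanced)

prefix-track : ∀ (f : Letter3 → Digit) {w} → ChungGraham (map f w) → ∀ u v → u ++ v ≡ w → ChungGraham (map f u)
prefix-track f cg u v refl = chungGraham-++ˡ (map f u) (map f v) (subst ChungGraham (map-++ f u v) cg)

odd-digit-zero : ∀ (f : Letter3 → Digit) {w} → ChungGraham (map f w) → ∀ u l v → u ++ l ∷ v ≡ w →
                 Odd (length u) → f l ≡ 0F
odd-digit-zero f cg u l v eq odd = toℕ-injective (chungGraham-∷ʳ-odd {map f u}
  (subst ChungGraham (map-++ f u (l ∷ [])) (prefix-track f cg (u ∷ʳ l) v (trans (∷ʳ-++ u l v) eq)))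
  (subst Odd (sym (length-map f u)) odd))

even-prefix-val< : ∀ (f : Letter3 → Digit) {w} → ChungGraham (map f w) → ∀ u v → u ++ v ≡ w →
                   Even (length u) → val (map f u) < fib (suc (suc (length u)))
even-prefix-val< f cg u v eq even =
  subst (val (map f u) <_) (trans (cong capacity (length-map f u)) (capacity-even (length u) (Even⇒evenᵇ (length u) even)))
    (val<capacity (prefix-track f cg u v eq))

band-of-vals : ∀ {F x y z} → x < F → y < F → z < F → Band (+ F) (+ z ℤ.- (+ x ℤ.+ + y))
band-of-vals {F} {x} {y} {z} x<F y<F z<F =
  ℤ.<-≤-trans (ℤ.neg-mono-< (ℤ.+<+ (+-mono-< x<F y<F))) (ℤ.i≤j+i _ (+ z)) ,
  ℤ.≤-<-trans (ℤ.i-j≤i (+ z) (+ x ℤ.+ + y)) (ℤ.+<+ z<F)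

balance-identity : ∀ x y z T → T ≡ (((x ℤ.+ y) ℤ.- z) ℤ.+ T) ℤ.+ (z ℤ.- (x ℤ.+ y))
balance-identity = solve-∀

balance : ∀ x y z T → ((x ℤ.+ y) ℤ.- z) ℤ.+ T ≡ 0ℤ → T ≡ z ℤ.- (x ℤ.+ y)
balance x y z T balanced =
  trans (balance-identity x y z T) (trans (cong (ℤ._+ (z ℤ.- (x ℤ.+ y))) balanced) (ℤ.+-identityˡ _))

excess-zero : ∀ {x y z} → x ≡ 0F → y ≡ 0F → z ≡ 0F → excess (x , y , z) ≡ 0ℤ
excess-zero refl refl refl = refl

module _ {w : List Letter3} (valid : CGSum w) where
  private
    cg₁ : ChungGraham (track₁ w)
    cg₁ = proj₁ valid
    cg₂ : ChungGraham (track₂ w)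
    cg₂ = proj₁ (proj₂ valid)
    cg₃ : ChungGraham (track₃ w)
    cg₃ = proj₁ (proj₂ (proj₂ valid))
    balanced : excessFrom 0 w ≡ 0ℤ
    balanced = Equivalence.to (sum⇔excess w) (proj₂ (proj₂ (proj₂ valid)))

  suffix-band : ∀ u v → u ++ v ≡ w → Even (length u) →
                Band (+ fib (suc (suc (length u)))) (excessFrom (length u) v)
  suffix-band u v eq even =
    subst (Band _) (sym (balance (+ x) (+ y) (+ z) (excessFrom (length u) v) split))
      (band-of-vals (even-prefix-val< proj₁ cg₁ u v eq even) (even-prefix-val< _ cg₂ u v eq even)
                    (even-prefix-val< _ cg₃ u v eq even))
    where
    x y z : ℕ
    x = val (track₁ u)
    y = val (track₂ u)
    z = val (track₃ u)
    split : ((+ x ℤ.+ + y) ℤ.- + z) ℤ.+ excessFrom (length u) v ≡ 0ℤ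
    split = trans (cong (ℤ._+ excessFrom (length u) v) (sym (excessFrom-val 0 u)))
                  (trans (sym (excessFrom-++ 0 u v)) (trans (cong (excessFrom 0) eq) balanced))

  odd-excess : ∀ u l v → u ++ l ∷ v ≡ w → Odd (length u) → excess l ≡ 0ℤ
  odd-excess u l v eq odd =
    excess-zero (odd-digit-zero proj₁ cg₁ u l v eq odd) (odd-digit-zero _ cg₂ u l v eq odd)
                (odd-digit-zero _ cg₃ u l v eq odd)

  carryRange : ∀ u v → u ++ v ≡ w → CarryRange (evenᵇ (length u)) (carry v)
  carryRange u []      _  = carryRange-zero _
  carryRange u (l ∷ v) eq = extend (evenᵇ (length u)) refl
    (subst (λ n → CarryRange (evenᵇ n) (carry v)) (length-∷ʳ u l) (carryRange (u ∷ʳ l) v (trans (∷ʳ-++ u l v) eq)))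
    where
    extend : ∀ p → evenᵇ (length u) ≡ p → CarryRange (not p) (carry v) → CarryRange p (carry (l ∷ v))
    extend true  even range = evenCarry-retreat (length u) (excess l) range
      (subst (Band _) (excessFrom-carry (length u) (l ∷ v)) (suffix-band u (l ∷ v) eq (evenᵇ⇒Even (length u) even)))
    extend false odd range = subst (λ e → OddCarry (retreat (carry v) e))
      (sym (odd-excess u l v eq (evenᵇ⇒Odd (length u) odd))) (oddCarry-retreat range)

  Synced : List Letter3 → List Letter3 → CarryState → Set
  Synced u v fresh    = u ≡ []
  Synced u v (pair k) = decodePair k ≡ carry v

  nextCarry-synced : ∀ u l v c → u ++ l ∷ v ≡ w → Synced u (l ∷ v) c → nextCarry c (excess l) ≡ carry v
  nextCarry-synced .[] l v fresh eq refl =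
    initialCarry-retreat (carry v) (excess l) (carryRange (l ∷ []) v eq)
      (trans (sym (excessFrom-carry 0 (l ∷ v))) (trans (cong (excessFrom 0) eq) balanced))
  nextCarry-synced u l v (pair k) eq decoded =
    trans (cong (λ p → advance p (excess l)) decoded) (advance-retreat (carry v) (excess l))

  sync : ∀ {u} → Reverse u → ∀ v → u ++ v ≡ w → ∃ λ c → Reaches carryAutomaton u c × Synced u v c
  sync []               v _  = fresh , [] , refl
  sync (u ∶ view ∶ʳ l) v eq with sync view (l ∷ v) (trans (sym (∷ʳ-++ u l v)) eq)
  ... | c , r , synced with carryRange-encodable _ (carryRange (u ∷ʳ l) v eq)
  ...   | k , encoded = pair k , r ∷ʳ⟨ moved ⟩ , decodePair-encodePair (carry v) encoded
    where
    moved : carryStep c l ≡ just (pair k)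
    moved rewrite nextCarry-synced u l v c (trans (sym (∷ʳ-++ u l v)) eq) synced | encoded = refl

  carry-complete : accepts carryAutomaton w ≡ true
  carry-complete with sync (reverseView w) [] (++-identityʳ w)
  ... | c , r , synced = Equivalence.from (accepts⇔reaches carryAutomaton w) (c , r , accepting c synced)
    where
    accepting : ∀ c → Synced w [] c → carryFinal c ≡ true
    accepting fresh    _       = refl
    accepting (pair k) decoded = dec-true (≡-dec ℤ._≟_ ℤ._≟_ (decodePair k) (0ℤ , 0ℤ)) decoded

-- The addition automaton

sumAutomaton : Automaton Letter3
sumAutomaton = comap proj₁ chungGrahamAutomaton
             ⊗ (comap (λ t → proj₁ (proj₂ t)) chungGrahamAutomaton
             ⊗ (comap (λ t → proj₂ (proj₂ t)) chungGrahamAutomaton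
             ⊗ carryAutomaton))

sumStates : Finite (Maybe (Automaton.State sumAutomaton))
sumStates = finite-Maybe (finite-× cgStates (finite-× cgStates (finite-× cgStates carryStates)))
  where
  cgStates : Finite CGState
  cgStates = finite-× finite-Bool finite-Bool
  carryStates : Finite CarryState
  carryStates = finite-Maybe (finite-× (finite-Fin 5) (finite-Fin 5))

sumDFA : DFA Letter3
sumDFA = toDFA sumAutomaton sumStates

∧-≡-true : ∀ {x y} → x ∧ y ≡ true → x ≡ true × y ≡ true
∧-≡-true {true} {true} _ = refl , refl

accepts-sum : ∀ w → accepts sumAutomaton w ≡
  accepts chungGrahamAutomaton (track₁ w) ∧ (accepts chungGrahamAutomaton (track₂ w) ∧
  (accepts chungGrahamAutomaton (track₃ w) ∧ accepts carryAutomaton w))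
accepts-sum w =
  trans (accepts-⊗ (comap proj₁ CG) _ w) (cong₂ _∧_ (accepts-comap proj₁ CG w)
  (trans (accepts-⊗ (comap (λ t → proj₁ (proj₂ t)) CG) _ w) (cong₂ _∧_ (accepts-comap (λ t → proj₁ (proj₂ t)) CG w)
  (trans (accepts-⊗ (comap (λ t → proj₂ (proj₂ t)) CG) carryAutomaton w)
         (cong (_∧ accepts carryAutomaton w) (accepts-comap (λ t → proj₂ (proj₂ t)) CG w))))))
  where
  CG : Automaton Digit
  CG = chungGrahamAutomaton

sumDFA-correct : ∀ w → DFA.accepts sumDFA w ≡ true ⇔ CGSum w
sumDFA-correct w = mk⇔ sound complete
  where
  open Equivalence
  sound : DFA.accepts sumDFA w ≡ true → CGSum w
  sound acc with ∧-≡-true (trans (sym (accepts-sum w)) (trans (sym (accepts-toDFA sumAutomaton sumStates w)) acc))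
  ... | a₁ , rest with ∧-≡-true rest
  ... | a₂ , rest′ with ∧-≡-true rest′
  ... | a₃ , a = to (accepts-chungGraham _) a₁ , to (accepts-chungGraham _) a₂ , to (accepts-chungGraham _) a₃ ,
                 from (sum⇔excess w) (carry-sound w a)
  complete : CGSum w → DFA.accepts sumDFA w ≡ true
  complete valid@(c₁ , c₂ , c₃ , _) =
    trans (accepts-toDFA sumAutomaton sumStates w) (trans (accepts-sum w)
      (cong₂ _∧_ (from (accepts-chungGraham (track₁ w)) c₁) (cong₂ _∧_ (from (accepts-chungGraham (track₂ w)) c₂)
        (cong₂ _∧_ (from (accepts-chungGraham (track₃ w)) c₃) (carry-complete valid)))))

-- Sums of words with two leading zeros

length-∷ʳ-∷ʳ : ∀ (u : Word) a b → length ((u ∷ʳ a) ∷ʳ b) ≡ suc (suc (length u))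
length-∷ʳ-∷ʳ u a b = trans (length-∷ʳ (u ∷ʳ a) b) (cong suc (length-∷ʳ u a))

top-two-zeros : ∀ x → 2 ≤ length x → digitAt x (length x ∸ 1) ≡ 0 → digitAt x (length x ∸ 2) ≡ 0 →
                ∃ λ x₀ → x ≡ (x₀ ∷ʳ 0F) ∷ʳ 0F
top-two-zeros x = go (reverseView x)
  where
  go : ∀ {x} → Reverse x → 2 ≤ length x → digitAt x (length x ∸ 1) ≡ 0 →
       digitAt x (length x ∸ 2) ≡ 0 → ∃ λ x₀ → x ≡ (x₀ ∷ʳ 0F) ∷ʳ 0F
  go (_ ∶ [] ∶ʳ _) (s≤s ())
  go (_ ∶ (x₀ ∶ _ ∶ʳ a) ∶ʳ b) _ last penultimate =
    x₀ , cong₂ (λ a b → (x₀ ∷ʳ a) ∷ʳ b) (toℕ-injective a≡0) (toℕ-injective b≡0)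
    where
    b≡0 : toℕ b ≡ 0
    b≡0 = trans (sym (digitAt-∷ʳ (x₀ ∷ʳ a) b))
            (trans (cong (λ n → digitAt ((x₀ ∷ʳ a) ∷ʳ b) (n ∸ 1)) (sym (length-∷ʳ (x₀ ∷ʳ a) b))) last)
    a≡0 : toℕ a ≡ 0
    a≡0 = trans (sym (digitAt-∷ʳ x₀ a)) (trans (sym (digitAt-∷ʳ-< (x₀ ∷ʳ a) b (length<∷ʳ x₀ a)))
            (trans (cong (λ n → digitAt ((x₀ ∷ʳ a) ∷ʳ b) (n ∸ 2)) (sym (length-∷ʳ-∷ʳ x₀ a b))) penultimate))

val-∷ʳ-0F : ∀ u → val (u ∷ʳ 0F) ≡ val u
val-∷ʳ-0F u = trans (val-∷ʳ u 0F) (+-identityʳ (val u))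

padded-sum-unique : ∀ (x₀ y₀ : Word) → ChungGraham ((x₀ ∷ʳ 0F) ∷ʳ 0F) → ChungGraham ((y₀ ∷ʳ 0F) ∷ʳ 0F) →
                    length x₀ ≡ length y₀ →
                    ∃! _≡_ λ (z : Word) → length z ≡ length ((x₀ ∷ʳ 0F) ∷ʳ 0F) × ChungGraham z ×
                                          val ((x₀ ∷ʳ 0F) ∷ʳ 0F) + val ((y₀ ∷ʳ 0F) ∷ʳ 0F) ≡ val z
padded-sum-unique x₀ y₀ cgx cgy len = z , (length-z , cg-z , sum-z) , λ (len′ , cg′ , sum′) →
  val-injective cg-z cg′ (trans length-z (sym len′)) (trans (sym sum-z) sum′)
  where
  n : ℕ
  n = length x₀
  x y : Word
  x = (x₀ ∷ʳ 0F) ∷ʳ 0F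
  y = (y₀ ∷ʳ 0F) ∷ʳ 0F

  val-x₀ : val x₀ < capacity n
  val-x₀ = val<capacity (chungGraham-++ˡ x₀ _ (chungGraham-++ˡ (x₀ ∷ʳ 0F) _ cgx))
  val-y₀ : val y₀ < capacity n
  val-y₀ = subst (λ m → val y₀ < capacity m) (sym len) (val<capacity (chungGraham-++ˡ y₀ _ (chungGraham-++ˡ (y₀ ∷ʳ 0F) _ cgy)))

  witness : ∃ λ z → length z ≡ suc (suc n) × ChungGraham z × val z ≡ val x₀ + val y₀
  witness = chungGraham-representation (suc (suc n)) (val x₀ + val y₀)
                     (<-≤-trans (+-mono-< val-x₀ val-y₀) (capacity-double n))
  z : Word
  z = proj₁ witness
  length-z : length z ≡ length x
  length-z = trans (proj₁ (proj₂ witness)) (sym (length-∷ʳ-∷ʳ x₀ 0F 0F))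
  cg-z : ChungGraham z
  cg-z = proj₁ (proj₂ (proj₂ witness))
  sum-z : val x + val y ≡ val z
  sum-z = trans (cong₂ _+_ (trans (val-∷ʳ-0F (x₀ ∷ʳ 0F)) (val-∷ʳ-0F x₀)) (trans (val-∷ʳ-0F (y₀ ∷ʳ 0F)) (val-∷ʳ-0F y₀)))
                (sym (proj₂ (proj₂ (proj₂ witness))))

sum-unique : ∀ (x y : Word) → ChungGraham x → ChungGraham y → length x ≡ length y → 2 ≤ length x →
             digitAt x (length x ∸ 1) ≡ 0 → digitAt x (length x ∸ 2) ≡ 0 →
             digitAt y (length y ∸ 1) ≡ 0 → digitAt y (length y ∸ 2) ≡ 0 →
             ∃! _≡_ λ (z : Word) → length z ≡ length x × ChungGraham z × val x + val y ≡ val z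
sum-unique x y cgx cgy len 2≤x x₁ x₂ y₁ y₂
  with top-two-zeros x 2≤x x₁ x₂ | top-two-zeros y (subst (2 ≤_) len 2≤x) y₁ y₂
... | x₀ , refl | y₀ , refl =
  padded-sum-unique x₀ y₀ cgx cgy (suc-injective (suc-injective
    (trans (sym (length-∷ʳ-∷ʳ x₀ 0F 0F)) (trans len (length-∷ʳ-∷ʳ y₀ 0F 0F)))))

mainTheorem2 : (Σ (DFA Letter3) λ A → ∀ (w : List Letter3) → (DFA.accepts A w ≡ true) ⇔ CGSum w)
    × (∀ (x y : Word) → ChungGraham x → ChungGraham y → length x ≡ length y → 2 ≤ length x →
       digitAt x (length x ∸ 1) ≡ 0 → digitAt x (length x ∸ 2) ≡ 0 →
       digitAt y (length y ∸ 1) ≡ 0 → digitAt y (length y ∸ 2) ≡ 0 →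
       ∃! _≡_ λ (z : Word) → length z ≡ length x × ChungGraham z × val x + val y ≡ val z)
mainTheorem2 = (sumDFA , sumDFA-correct) , sum-unique
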